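{- Let $n,k\ge1$. If $nK_2$ admits a $k$-super graceful labeling in which all edge labels are even, then either (i) $n\equiv 3\pmod 4$ and $k$ is even, or (ii) $n\equiv 0\pmod 4$, or (iii) $n\equiv 1\pmod 4$ and $k$ is odd.
   Context: $nK_2$ denotes the disjoint union of $n$ copies of the complete graph $K_2$ (a perfect matching with $n$ edges and $2n$ vertices). For integers $a\le b$, $[a,b]$ is the set of integers between $a$ and $b$ inclusive. For $k\ge 1$, a $k$-super graceful labeling of a graph $G=(V,E)$ with $p$ vertices and $q$ edges is a bijection $f:V\cup E\to[k,k+p+q-1]$ with $f(uv)=|f(u)-f(v)|$ for every edge $uv$. -}

module Defs where

open import Data.Nat using (ℕ; _+_; _*_; _∸_; _≤_; _<_)
open import Data.Nat.Properties using ()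
open import Data.Fin using (Fin)
open import Data.Bool using (Bool; true; false)
open import Data.Product using (_×_; _,_; Σ; ∃)
open import Data.Sum using (_⊎_; inj₁; inj₂)
open import Relation.Binary.PropositionalEquality using (_≡_)
open import Function.Definitions using (Injective)

-- The graph nK₂: vertices are pairs (i , b) with i : Fin n, b : Bool;
-- the i-th edge joins (i , false) and (i , true).  Edges are indexed by Fin n.
Vertex : ℕ → Set
Vertex n = Fin n × Bool

Edge : ℕ → Set
Edge n = Fin n

Elem : ℕ → Set
Elem n = Vertex n ⊎ Edge n

∣_-_∣ : ℕ → ℕ → ℕ
∣ a - b ∣ = (a ∸ b) + (b ∸ a)

InInterval : ℕ → ℕ → ℕ → Set
InInterval a b x = (a ≤ x) × (x ≤ b)

-- A k-super graceful labeling of nK₂ (p = 2n vertices, q = n edges):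
-- a bijection f : V ⊎ E → [k , k + p + q - 1] with f(uv) = |f(u) - f(v)|.
record SuperGraceful (k n : ℕ) : Set where
  field
    f        : Elem n → ℕ
    inRange  : ∀ x → InInterval k (k + (2 * n + n) ∸ 1) (f x)
    injective : Injective _≡_ _≡_ f
    surjective : ∀ m → InInterval k (k + (2 * n + n) ∸ 1) m → Σ (Elem n) (λ x → f x ≡ m)
    edgeCond : ∀ (i : Edge n) → f (inj₂ i) ≡ ∣ f (inj₁ (i , false)) - f (inj₁ (i , true)) ∣

Even : ℕ → Set
Even m = Σ ℕ (λ t → m ≡ 2 * t)

AllEdgeLabelsEven : ∀ {k n} → SuperGraceful k n → Set
AllEdgeLabelsEven {n = n} L = ∀ (i : Edge n) → Even (SuperGraceful.f L (inj₂ i))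

module Submission where

-- Let f be a k-super graceful labeling of nK₂ all of whose edge labels are
-- even, and let S be the sum of all 3n labels.  We compute the parity of S
-- in two ways.
--   * Since f is a bijection onto [k, k+3n-1], S = k + (k+1) + … + (k+3n-1),
--     whose parity depends only on k mod 2 and on 3n mod 4.
--   * Grouping the labels by edge uv, S is a sum of terms f(uv) + f(u) + f(v);
--     f(u) + f(v) has the parity of |f(u) - f(v)| = f(uv), which is even,
--     so S is even.
-- Comparing the two, S even forces exactly the residues listed in the theorem.

open import Defs
open import Data.Nat using (ℕ; _≤_; _%_)
open import Data.Product using (_×_; Σ)
open import Data.Sum using (_⊎_)
open import Relation.Binary.PropositionalEquality using (_≡_)

open import Data.Nat using (zero; suc; _+_; _*_; _∸_; _<_; s≤s)
open import Data.Nat.Properties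
  using (+-suc; +-identityʳ; +-assoc; m+n∸m≡n; m+[n∸m]≡n; ∸-monoˡ-<;
         +-monoʳ-<; m≤m+n; +-cancelˡ-≡; +-0-commutativeMonoid)
open import Data.Nat.Tactic.RingSolver using (solve-∀)
open import Data.Fin using (Fin; toℕ; fromℕ<; splitAt; _↑ˡ_; _↑ʳ_)
  renaming (zero to fzero; suc to fsuc)
open import Data.Fin.Properties
  using (toℕ-fromℕ<; toℕ-injective; toℕ<n; splitAt-↑ˡ; splitAt-↑ʳ;
         splitAt⁻¹-↑ˡ; splitAt⁻¹-↑ʳ)
open import Data.Bool using (Bool; true; false; not; _xor_; if_then_else_)
open import Data.Bool.Properties using (not-involutive; not-distribˡ-xor; xor-same)
open import Data.Product using (_,_; proj₁; proj₂; ∃)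
open import Data.Sum using (inj₁; inj₂; [_,_]′)
open import Function.Base using (_∘_)
open import Function.Bundles using (_↔_; mk↔ₛ′)
open import Function.Definitions using (Injective)
open import Relation.Binary.PropositionalEquality
  using (refl; sym; trans; cong; cong₂; subst; module ≡-Reasoning)
open import Algebra.Properties.CommutativeMonoid.Sum +-0-commutativeMonoid
  using (sum; sum-cong-≗; ∑-distrib-+; sum-permute)

open ≡-Reasoning

isOdd : ℕ → Bool
isOdd zero    = false
isOdd (suc m) = not (isOdd m)

isOdd-+ : ∀ a b → isOdd (a + b) ≡ isOdd a xor isOdd b
isOdd-+ zero    b = refl
isOdd-+ (suc a) b = trans (cong not (isOdd-+ a b)) (not-distribˡ-xor (isOdd a) (isOdd b))

isOdd-double : ∀ t → isOdd (2 * t) ≡ false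
isOdd-double t = begin
  isOdd (t + (t + 0))         ≡⟨ cong (λ u → isOdd (t + u)) (+-identityʳ t) ⟩
  isOdd (t + t)               ≡⟨ isOdd-+ t t ⟩
  isOdd t xor isOdd t         ≡⟨ xor-same (isOdd t) ⟩
  false                       ∎

Even⇒isOdd≡false : ∀ {m} → Even m → isOdd m ≡ false
Even⇒isOdd≡false (t , m≡2t) = trans (cong isOdd m≡2t) (isOdd-double t)

isOdd-∣-∣ : ∀ a b → isOdd ∣ a - b ∣ ≡ isOdd (a + b)
isOdd-∣-∣ zero    zero    = refl
isOdd-∣-∣ zero    (suc b) = refl
isOdd-∣-∣ (suc a) zero    = refl
isOdd-∣-∣ (suc a) (suc b) = begin
  isOdd ∣ a - b ∣                ≡⟨ isOdd-∣-∣ a b ⟩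
  isOdd (a + b)                  ≡⟨ sym (not-involutive (isOdd (a + b))) ⟩
  isOdd (suc (suc (a + b)))      ≡⟨ cong (isOdd ∘ suc) (sym (+-suc a b)) ⟩
  isOdd (suc a + suc b)          ∎

%2≡isOdd : ∀ m → m % 2 ≡ (if isOdd m then 1 else 0)
%2≡isOdd zero          = refl
%2≡isOdd (suc zero)    = refl
%2≡isOdd (suc (suc m)) =
  trans (%2≡isOdd m) (cong (λ b → if b then 1 else 0) (sym (not-involutive (isOdd m))))

%2-of-parity : ∀ m {b} → isOdd m ≡ b → m % 2 ≡ (if b then 1 else 0)
%2-of-parity m parity = trans (%2≡isOdd m) (cong (λ b → if b then 1 else 0) parity)

consecutiveParity : ℕ → ℕ → Bool
consecutiveParity k zero    = false
consecutiveParity k (suc L) = isOdd k xor consecutiveParity (suc k) L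

isOdd-consecutiveSum : ∀ L k →
  isOdd (sum (λ (j : Fin L) → k + toℕ j)) ≡ consecutiveParity k L
isOdd-consecutiveSum zero    k = refl
isOdd-consecutiveSum (suc L) k = begin
  isOdd ((k + 0) + sum (λ (j : Fin L) → k + suc (toℕ j)))
    ≡⟨ isOdd-+ (k + 0) _ ⟩
  isOdd (k + 0) xor isOdd (sum (λ (j : Fin L) → k + suc (toℕ j)))
    ≡⟨ cong₂ _xor_ (cong isOdd (+-identityʳ k))
                   (cong isOdd (sum-cong-≗ {L} (λ j → +-suc k (toℕ j)))) ⟩
  isOdd k xor isOdd (sum (λ (j : Fin L) → suc k + toℕ j))
    ≡⟨ cong (isOdd k xor_) (isOdd-consecutiveSum L (suc k)) ⟩
  isOdd k xor consecutiveParity (suc k) L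
    ∎

consecutiveParity-shift : ∀ L k → consecutiveParity (2 + k) L ≡ consecutiveParity k L
consecutiveParity-shift zero    k = refl
consecutiveParity-shift (suc L) k =
  cong₂ _xor_ (not-involutive (isOdd k)) (consecutiveParity-shift L (suc k))

-- Four consecutive integers have an even sum, so the parity has period 4 in L.
consecutiveParity-period : ∀ L k → consecutiveParity k (4 + L) ≡ consecutiveParity k L
consecutiveParity-period L k
  rewrite consecutiveParity-shift L (2 + k) | consecutiveParity-shift L k
  with isOdd k
... | true  = not-involutive (consecutiveParity k L)
... | false = not-involutive (consecutiveParity k L)

Admissible : ℕ → ℕ → Set
Admissible n k = ((n % 4 ≡ 3) × (k % 2 ≡ 0)) ⊎ ((n % 4 ≡ 0) ⊎ ((n % 4 ≡ 1) × (k % 2 ≡ 1)))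

-- 3(n + 4) = 3n + 12, in the shape in which 3n appears in Defs.
triple-step : ∀ m → 2 * (4 + m) + (4 + m) ≡ 4 + (4 + (4 + (2 * m + m)))
triple-step = solve-∀

-- If k + … + (k+3n-1) is even then (n, k) is admissible.  By periodicity it
-- suffices to check n < 4; note (4 + m) % 4 reduces to m % 4.
admissible-of-even-sum : ∀ n k → consecutiveParity k (2 * n + n) ≡ false → Admissible n k
admissible-of-even-sum zero k _ = inj₂ (inj₁ refl)
admissible-of-even-sum (suc zero) k even with isOdd k in odd
admissible-of-even-sum (suc zero) k even  | true = inj₂ (inj₂ (refl , %2-of-parity k odd))
admissible-of-even-sum (suc zero) k ()    | false
admissible-of-even-sum (suc (suc zero)) k even with isOdd k
admissible-of-even-sum (suc (suc zero)) k ()    | true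
admissible-of-even-sum (suc (suc zero)) k ()    | false
admissible-of-even-sum (suc (suc (suc zero))) k even with isOdd k in odd
admissible-of-even-sum (suc (suc (suc zero))) k ()    | true
admissible-of-even-sum (suc (suc (suc zero))) k even  | false = inj₁ (refl , %2-of-parity k odd)
admissible-of-even-sum (suc (suc (suc (suc m)))) k even =
  admissible-of-even-sum m k (begin
    consecutiveParity k (2 * m + m)                         ≡⟨ sym (periodic (2 * m + m)) ⟩
    consecutiveParity k (4 + (4 + (4 + (2 * m + m))))       ≡⟨ cong (consecutiveParity k) (sym (triple-step m)) ⟩
    consecutiveParity k (2 * (4 + m) + (4 + m))             ≡⟨ even ⟩
    false                                                   ∎)
  where
  periodic : ∀ L → consecutiveParity k (4 + (4 + (4 + L))) ≡ consecutiveParity k L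
  periodic L = trans (consecutiveParity-period (4 + (4 + L)) k)
                 (trans (consecutiveParity-period (4 + L) k) (consecutiveParity-period L k))

sum-↑ : ∀ a {b} (h : Fin (a + b) → ℕ) →
  sum h ≡ sum (h ∘ (_↑ˡ b)) + sum (h ∘ (a ↑ʳ_))
sum-↑ zero    h = refl
sum-↑ (suc a) h =
  trans (cong (h fzero +_) (sum-↑ a (h ∘ fsuc))) (sym (+-assoc (h fzero) _ _))

sum-even : ∀ {m} (h : Fin m → ℕ) → (∀ i → isOdd (h i) ≡ false) → isOdd (sum h) ≡ false
sum-even {zero}  h _    = refl
sum-even {suc m} h even = begin
  isOdd (h fzero + sum (h ∘ fsuc))           ≡⟨ isOdd-+ (h fzero) _ ⟩
  isOdd (h fzero) xor isOdd (sum (h ∘ fsuc)) ≡⟨ cong₂ _xor_ (even fzero) (sum-even (h ∘ fsuc) (even ∘ fsuc)) ⟩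
  false                                      ∎

-- A labelling F of Fin m that is a bijection onto the interval [k, k+L) has
-- the same sum as the interval: its values are a permutation of k, …, k+L-1.
sum-interval-bijection : ∀ {m L} k (F : Fin m → ℕ) →
  (∀ i → k ≤ F i × F i < k + L) → Injective _≡_ _≡_ F →
  (∀ v → k ≤ v → v < k + L → ∃ λ i → F i ≡ v) →
  sum F ≡ sum (λ (j : Fin L) → k + toℕ j)
sum-interval-bijection {m} {L} k F range injective onto = begin
  sum F                                ≡⟨ sum-cong-≗ (λ i → sym (offset-correct i)) ⟩
  sum (λ i → k + toℕ (offset i))       ≡⟨ sym (sum-permute (λ j → k + toℕ j) π) ⟩
  sum (λ (j : Fin L) → k + toℕ j)      ∎
  where
  offset : Fin m → Fin L
  offset i = fromℕ< (subst (F i ∸ k <_) (m+n∸m≡n k L)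
                             (∸-monoˡ-< (proj₂ (range i)) (proj₁ (range i))))

  offset-correct : ∀ i → k + toℕ (offset i) ≡ F i
  offset-correct i = trans (cong (k +_) (toℕ-fromℕ< _)) (m+[n∸m]≡n (proj₁ (range i)))

  preimage : Fin L → Fin m
  preimage j = proj₁ (onto (k + toℕ j) (m≤m+n k (toℕ j)) (+-monoʳ-< k (toℕ<n j)))

  preimage-correct : ∀ j → F (preimage j) ≡ k + toℕ j
  preimage-correct j = proj₂ (onto (k + toℕ j) (m≤m+n k (toℕ j)) (+-monoʳ-< k (toℕ<n j)))

  π : Fin m ↔ Fin L
  π = mk↔ₛ′ offset preimage
    (λ j → toℕ-injective (+-cancelˡ-≡ k _ _
             (trans (offset-correct (preimage j)) (preimage-correct j))))
    (λ i → injective (trans (preimage-correct (offset i)) (offset-correct i)))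

vertex : ∀ {n} → Fin n → Bool → Elem n
vertex i b = inj₁ (i , b)

edge : ∀ {n} → Fin n → Elem n
edge = inj₂

-- V ∪ E is listed as: the n edges, the n `false` endpoints, the n `true` endpoints.
decode : ∀ n → Fin (n + (n + n)) → Elem n
decode n i = [ edge , (λ j → [ (λ a → vertex a false) , (λ b → vertex b true) ]′ (splitAt n j)) ]′
               (splitAt n i)

encode : ∀ n → Elem n → Fin (n + (n + n))
encode n (inj₂ e)           = e ↑ˡ (n + n)
encode n (inj₁ (a , false)) = n ↑ʳ (a ↑ˡ n)
encode n (inj₁ (a , true))  = n ↑ʳ (n ↑ʳ a)

decode-encode : ∀ n x → decode n (encode n x) ≡ x
decode-encode n (inj₂ e)
  rewrite splitAt-↑ˡ n e (n + n) = refl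
decode-encode n (inj₁ (a , false))
  rewrite splitAt-↑ʳ n (n + n) (a ↑ˡ n) | splitAt-↑ˡ n a n = refl
decode-encode n (inj₁ (a , true))
  rewrite splitAt-↑ʳ n (n + n) (n ↑ʳ a) | splitAt-↑ʳ n n a = refl

encode-decode : ∀ n i → encode n (decode n i) ≡ i
encode-decode n i with splitAt n i in split₁
... | inj₁ e = splitAt⁻¹-↑ˡ split₁
... | inj₂ j with splitAt n j in split₂
...   | inj₁ a = trans (cong (n ↑ʳ_) (splitAt⁻¹-↑ˡ split₂)) (splitAt⁻¹-↑ʳ split₁)
...   | inj₂ b = trans (cong (n ↑ʳ_) (splitAt⁻¹-↑ʳ split₂)) (splitAt⁻¹-↑ʳ split₁)

sum-decode : ∀ n (F : Elem n → ℕ) →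
  sum (F ∘ decode n) ≡ sum (F ∘ edge) + sum (λ i → F (vertex i false) + F (vertex i true))
sum-decode n F = begin
  sum (F ∘ decode n)
    ≡⟨ sum-↑ n {n + n} (F ∘ decode n) ⟩
  sum (λ (i : Fin n) → F (decode n (i ↑ˡ (n + n)))) + sum (λ j → F (decode n (n ↑ʳ j)))
    ≡⟨ cong₂ _+_ (sum-cong-≗ {n} (λ i → cong F (decode-encode n (edge i))))
                 (sum-↑ n {n} (λ j → F (decode n (n ↑ʳ j)))) ⟩
  sum (F ∘ edge) + (sum (λ (i : Fin n) → F (decode n (n ↑ʳ (i ↑ˡ n))))
                  + sum (λ i → F (decode n (n ↑ʳ (n ↑ʳ i)))))
    ≡⟨ cong (sum (F ∘ edge) +_)
         (cong₂ _+_ (sum-cong-≗ {n} (λ i → cong F (decode-encode n (vertex i false))))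
                    (sum-cong-≗ {n} (λ i → cong F (decode-encode n (vertex i true))))) ⟩
  sum (F ∘ edge) + (sum (λ i → F (vertex i false)) + sum (λ i → F (vertex i true)))
    ≡⟨ cong (sum (F ∘ edge) +_) (sym (∑-distrib-+ (λ i → F (vertex i false)) (λ i → F (vertex i true)))) ⟩
  sum (F ∘ edge) + sum (λ i → F (vertex i false) + F (vertex i true))
    ∎

-- For k ≥ 1 the closed interval [k, k+m-1] is the half-open interval [k, k+m).
inInterval⇒< : ∀ {k m x} → 1 ≤ k → InInterval k (k + m ∸ 1) x → k ≤ x × x < k + m
inInterval⇒< (s≤s _) (lo , hi) = lo , s≤s hi

<⇒inInterval : ∀ {k m x} → 1 ≤ k → k ≤ x → x < k + m → InInterval k (k + m ∸ 1) x
<⇒inInterval (s≤s _) lo (s≤s hi) = lo , hi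

labelSum-interval : ∀ {k n} → 1 ≤ k → (L : SuperGraceful k n) →
  sum (SuperGraceful.f L ∘ decode n) ≡ sum (λ (j : Fin (2 * n + n)) → k + toℕ j)
labelSum-interval {k} {n} 1≤k L = sum-interval-bijection k (f ∘ decode n)
  (λ i → inInterval⇒< 1≤k (inRange (decode n i)))
  (λ {i} {j} fi≡fj → begin
     i                         ≡⟨ sym (encode-decode n i) ⟩
     encode n (decode n i)     ≡⟨ cong (encode n) (injective fi≡fj) ⟩
     encode n (decode n j)     ≡⟨ encode-decode n j ⟩
     j                         ∎)
  (λ v lo hi → let (x , fx≡v) = surjective v (<⇒inInterval 1≤k lo hi)
               in encode n x , trans (cong f (decode-encode n x)) fx≡v)
  where open SuperGraceful L

labelSum-even : ∀ {k n} (L : SuperGraceful k n) → AllEdgeLabelsEven L →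
  isOdd (sum (SuperGraceful.f L ∘ decode n)) ≡ false
labelSum-even {n = n} L evenEdges = begin
  isOdd (sum (f ∘ decode n))
    ≡⟨ cong isOdd (sum-decode n f) ⟩
  isOdd (sum (f ∘ edge) + sum endpointSum)
    ≡⟨ isOdd-+ (sum (f ∘ edge)) (sum endpointSum) ⟩
  isOdd (sum (f ∘ edge)) xor isOdd (sum endpointSum)
    ≡⟨ cong₂ _xor_ (sum-even (f ∘ edge) (λ i → Even⇒isOdd≡false (evenEdges i)))
                   (sum-even endpointSum endpointSum-even) ⟩
  false
    ∎
  where
  open SuperGraceful L

  endpointSum : Fin n → ℕ
  endpointSum i = f (vertex i false) + f (vertex i true)

  -- f(u) + f(v) has the parity of |f(u) - f(v)| = f(uv), which is even
  endpointSum-even : ∀ i → isOdd (endpointSum i) ≡ false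
  endpointSum-even i = begin
    isOdd (endpointSum i)                             ≡⟨ sym (isOdd-∣-∣ (f (vertex i false)) (f (vertex i true))) ⟩
    isOdd ∣ f (vertex i false) - f (vertex i true) ∣  ≡⟨ cong isOdd (sym (edgeCond i)) ⟩
    isOdd (f (edge i))                                ≡⟨ Even⇒isOdd≡false (evenEdges i) ⟩
    false                                             ∎

lemma3p1 : ∀ (n k : ℕ) → 1 ≤ n → 1 ≤ k →
    Σ (SuperGraceful k n) AllEdgeLabelsEven →
    ((n % 4 ≡ 3) × (k % 2 ≡ 0)) ⊎ ((n % 4 ≡ 0) ⊎ ((n % 4 ≡ 1) × (k % 2 ≡ 1)))
lemma3p1 n k _ 1≤k (L , evenEdges) = admissible-of-even-sum n k (begin
  consecutiveParity k (2 * n + n)                         ≡⟨ sym (isOdd-consecutiveSum (2 * n + n) k) ⟩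
  isOdd (sum (λ (j : Fin (2 * n + n)) → k + toℕ j))       ≡⟨ cong isOdd (sym (labelSum-interval 1≤k L)) ⟩
  isOdd (sum (SuperGraceful.f L ∘ decode n))              ≡⟨ labelSum-even L evenEdges ⟩
  false                                                   ∎)
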